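{- For $n=7$, $n=8$, and every $n\geq 10$, there are infinitely many CS $n$-sets whose sum of entries is zero.
   Context: A CS-set is a finite multiset $\langle a_1,\dots,a_n\rangle$ of integers (repeated elements allowed, order irrelevant) such that $a_1^3+a_2^3+\cdots+a_n^3=(a_1+a_2+\cdots+a_n)^2$, where it is required that no $a_i$ equals $0$ and that the multiset does not contain both $k$ and $-k$ for any integer $k$. A CS $n$-set is a CS-set with exactly $n$ elements (counted with multiplicity). -}

module Defs where

open import Data.Nat using (ℕ)
open import Data.Integer using (ℤ; _+_; -_; _^_; 0ℤ)
open import Data.List using (List; length; foldr; map)
open import Data.List.Membership.Propositional using (_∈_; _∉_)
open import Data.List.Relation.Unary.All using (All)
open import Data.List.Relation.Binary.Permutation.Propositional using (_↭_)
open import Data.Product using (_×_; ∃)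
open import Relation.Binary.PropositionalEquality using (_≡_; _≢_)
open import Relation.Nullary using (¬_)

-- A finite multiset of integers is represented by a list, considered up to
-- permutation (_↭_).

sumℤ : List ℤ → ℤ
sumℤ = foldr _+_ 0ℤ

CubeSquare : List ℤ → Set
CubeSquare l = sumℤ (map (λ a → a ^ 3) l) ≡ (sumℤ l) ^ 2

NoZero : List ℤ → Set
NoZero l = All (λ a → a ≢ 0ℤ) l

NoOpposite : List ℤ → Set
NoOpposite l = All (λ k → - k ∉ l) l

IsCSSet : List ℤ → Set
IsCSSet l = CubeSquare l × NoZero l × NoOpposite l

IsCSnSet : ℕ → List ℤ → Set
IsCSnSet n l = IsCSSet l × length l ≡ n

ZeroSumCSnSet : ℕ → List ℤ → Set
ZeroSumCSnSet n l = IsCSnSet n l × sumℤ l ≡ 0ℤ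

-- "there are infinitely many multisets satisfying P": for every finite list
-- of multisets there is one satisfying P that is not (up to permutation)
-- any of them.
InfinitelyManyMultisets : (List ℤ → Set) → Set
InfinitelyManyMultisets P =
  (L : List (List ℤ)) → ∃ λ l → P l × All (λ m → ¬ (l ↭ m)) L

{-# OPTIONS --safe #-}
-- A list of linear forms a t + b whose sum and sum of cubes vanish identically in t
-- (equivalently, whose moments Σa, Σb, Σa³, Σa²b, Σab², Σb³ all vanish) evaluates at every
-- integer t to a multiset with zero sum and zero cube sum, hence a zero-sum CS-set as soon as it
-- has no zero and no pair of opposite entries. If the constants b are bounded by c and t > 2c,
-- two forms take opposite values only when they are opposite forms, so a list of forms with no
-- opposite pair gives a CS-set for every large t, and these are pairwise distinct since their
-- entries grow with t. Appending k copies of a block of five constants with zero sum and zero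
-- cube sum, such as ⟨−10, −4, −2, 7, 9⟩, raises the size by 5k; lists of sizes 7, 8, 10, 11 and
-- 14 then cover n = 7, 8 and every residue class modulo 5 of n ≥ 10.
module Submission where

open import Defs
open import Agda.Builtin.FromNat using (Number; fromNat)
open import Agda.Builtin.FromNeg using (Negative; fromNeg)
open import Data.Nat as ℕ using (ℕ; zero; suc; _≤_; _<_; s≤s; ≢-nonZero)
import Data.Nat.Literals as ℕ
import Data.Nat.Properties as ℕₚ
open import Data.Nat.DivMod using (_%_; _/_; m≡m%n+[m/n]*n; m%n<n)
open import Data.Nat.ListAction using (sum)
open import Data.Integer using (ℤ; +_; 0ℤ; 1ℤ; ∣_∣; -_; _+_; _*_; _-_; _^_)
import Data.Integer.Literals as ℤ
import Data.Integer.Properties as ℤₚ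
open import Data.Integer.Tactic.RingSolver using (solve-∀)
open import Data.List using (List; []; _∷_; _++_; map; length; concat; replicate)
import Data.List.Properties as List
open import Data.List.Membership.Propositional using (_∈_; _∉_)
open import Data.List.Membership.Propositional.Properties
  using (∈-map⁺; ∈-map⁻; ∈-++⁺ˡ; ∈-++⁻; ∈-concat⁺′)
open import Data.Product.Properties using (≡-dec)
open import Data.List.Membership.DecPropositional (≡-dec ℤₚ._≟_ ℤₚ._≟_) using (_∈?_)
open import Data.List.Relation.Binary.Subset.Propositional using (_⊆_)
open import Data.List.Relation.Binary.Subset.Propositional.Properties
  using (++⁺ʳ; All-resp-⊇)
open import Data.List.Relation.Binary.Permutation.Propositional using (_↭_)
open import Data.List.Relation.Binary.Permutation.Propositional.Properties
  using (∈-resp-↭)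
open import Data.List.Relation.Unary.All as All using (All; []; _∷_; all?)
import Data.List.Relation.Unary.All.Properties as All
open import Data.List.Relation.Unary.Any using (here; there)
open import Data.Product using (_×_; _,_; proj₁; proj₂; uncurry)
open import Data.Sum using (_⊎_; inj₁; inj₂)
open import Data.Unit using (tt)
open import Relation.Nullary using (¬_; Dec; yes; no; contradiction)
open import Relation.Nullary.Decidable using (¬?; _×-dec_; map′; from-yes)
open import Relation.Binary.PropositionalEquality
  using (_≡_; _≢_; refl; sym; trans; cong; cong₂; subst)

instance
  ℕ-number : Number ℕ
  ℕ-number = ℕ.number

  ℤ-number : Number ℤ
  ℤ-number = ℤ.number

  ℤ-negative : Negative ℤ
  ℤ-negative = ℤ.negative

private
  variable
    A : Set

sumℤ-++ : ∀ l m → sumℤ (l ++ m) ≡ sumℤ l + sumℤ m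
sumℤ-++ []      m = sym (ℤₚ.+-identityˡ (sumℤ m))
sumℤ-++ (x ∷ l) m =
  trans (cong (λ s → x + s) (sumℤ-++ l m)) (sym (ℤₚ.+-assoc x (sumℤ l) (sumℤ m)))

∈⇒≤sum : ∀ {n ns} → n ∈ ns → n ≤ sum ns
∈⇒≤sum (here refl)            = ℕₚ.m≤m+n _ _
∈⇒≤sum {ns = m ∷ _} (there p) = ℕₚ.≤-trans (∈⇒≤sum p) (ℕₚ.m≤n+m _ m)

length-concat-replicate : ∀ k (xs : List A) → length (concat (replicate k xs)) ≡ k ℕ.* length xs
length-concat-replicate zero    xs = refl
length-concat-replicate (suc k) xs =
  trans (List.length-++ xs) (cong (length xs ℕ.+_) (length-concat-replicate k xs))

concat-replicate-⊆ : ∀ k (xs : List A) → concat (replicate k xs) ⊆ xs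
concat-replicate-⊆ (suc k) xs p with ∈-++⁻ xs p
... | inj₁ p∈xs   = p∈xs
... | inj₂ p∈rest = concat-replicate-⊆ k xs p∈rest

record Balanced (l : List ℤ) : Set where
  constructor balanced
  field
    sum≡0   : sumℤ l ≡ 0ℤ
    cubes≡0 : sumℤ (map (_^ 3) l) ≡ 0ℤ

Balanced⇒CubeSquare : ∀ {l} → Balanced l → CubeSquare l
Balanced⇒CubeSquare (balanced sum≡0 cubes≡0) = trans cubes≡0 (sym (cong (_^ 2) sum≡0))

Balanced-++ : ∀ {l m} → Balanced l → Balanced m → Balanced (l ++ m)
Balanced-++ {l} {m} (balanced s c) (balanced s′ c′) = balanced
  (trans (sumℤ-++ l m) (cong₂ _+_ s s′))
  (trans (cong sumℤ (List.map-++ (_^ 3) l m))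
    (trans (sumℤ-++ (map (_^ 3) l) (map (_^ 3) m)) (cong₂ _+_ c c′)))

Balanced-map-concat-replicate : ∀ (f : A → ℤ) k xs →
  Balanced (map f xs) → Balanced (map f (concat (replicate k xs)))
Balanced-map-concat-replicate f zero    xs _   = balanced refl refl
Balanced-map-concat-replicate f (suc k) xs bal =
  subst Balanced (sym (List.map-++ f xs _))
    (Balanced-++ bal (Balanced-map-concat-replicate f k xs bal))

NoOpposite⇒NoZero : ∀ {l} → NoOpposite l → NoZero l
NoOpposite⇒NoZero noOpp = All.tabulate λ { x∈l refl → All.lookup noOpp x∈l x∈l }

height : List (List ℤ) → ℕ
height L = sum (map ∣_∣ (concat L))

height<∣x∣⇒¬↭ : ∀ {x l} L → x ∈ l → height L < ∣ x ∣ → All (λ m → ¬ (l ↭ m)) L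
height<∣x∣⇒¬↭ L x∈l h<∣x∣ = All.tabulate λ m∈L l↭m →
  ℕₚ.<⇒≱ h<∣x∣ (∈⇒≤sum (∈-map⁺ ∣_∣ (∈-concat⁺′ (∈-resp-↭ l↭m x∈l) m∈L)))

Form : Set
Form = ℤ × ℤ

eval : ℤ → Form → ℤ
eval x (a , b) = a * x + b

neg : Form → Form
neg (a , b) = - a , - b

Bounded : ℕ → Form → Set
Bounded c (_ , b) = ∣ b ∣ ≤ c

NoOppositeForms : List Form → Set
NoOppositeForms S = All (λ p → neg p ∉ S) S

NoOppositeForms-⊆ : ∀ {S T} → S ⊆ T → NoOppositeForms T → NoOppositeForms S
NoOppositeForms-⊆ S⊆T noOpp =
  All.tabulate λ p∈S neg-p∈S → All.lookup noOpp (S⊆T p∈S) (S⊆T neg-p∈S)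

eval-neg : ∀ x p → eval x (neg p) ≡ - eval x p
eval-neg x (a , b) = lemma a b x
  where
  lemma : ∀ a b x → - a * x + - b ≡ - (a * x + b)
  lemma = solve-∀

t≤∣a*t+b∣+∣b∣ : ∀ {a} b t → a ≢ 0ℤ → t ≤ ∣ a * + t + b ∣ ℕ.+ ∣ b ∣
t≤∣a*t+b∣+∣b∣ {a} b t a≢0 = begin
  t                          ≤⟨ ℕₚ.m≤n*m t ∣ a ∣ {{≢-nonZero (λ ∣a∣≡0 → a≢0 (ℤₚ.∣i∣≡0⇒i≡0 ∣a∣≡0))}} ⟩
  ∣ a ∣ ℕ.* t                ≡⟨ ℤₚ.∣i*j∣≡∣i∣*∣j∣ a (+ t) ⟨
  ∣ a * + t ∣                ≡⟨ cong ∣_∣ (cancel (a * + t) b) ⟩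
  ∣ a * + t + b - b ∣        ≤⟨ ℤₚ.∣i-j∣≤∣i∣+∣j∣ (a * + t + b) b ⟩
  ∣ a * + t + b ∣ ℕ.+ ∣ b ∣  ∎
  where
  open ℕₚ.≤-Reasoning
  cancel : ∀ u b → u ≡ u + b - b
  cancel = solve-∀

eval≡0⇒≡0 : ∀ {t} p → ∣ proj₂ p ∣ < t → eval (+ t) p ≡ 0ℤ → p ≡ (0ℤ , 0ℤ)
eval≡0⇒≡0 {t} (a , b) ∣b∣<t a*t+b≡0 with a ℤₚ.≟ 0ℤ
... | yes refl = cong (0ℤ ,_) (trans (sym (ℤₚ.+-identityˡ b)) a*t+b≡0)
... | no a≢0   = contradiction
  (subst (λ v → t ≤ ∣ v ∣ ℕ.+ ∣ b ∣) a*t+b≡0 (t≤∣a*t+b∣+∣b∣ b t a≢0)) (ℕₚ.<⇒≱ ∣b∣<t)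

eval-injective : ∀ {t} p q → ∣ proj₂ p ∣ ℕ.+ ∣ proj₂ q ∣ < t →
  eval (+ t) p ≡ eval (+ t) q → p ≡ q
eval-injective {t} (a , b) (a′ , b′) small eq =
  cong₂ _,_ (ℤₚ.i-j≡0⇒i≡j a a′ (cong proj₁ difference≡0))
            (ℤₚ.i-j≡0⇒i≡j b b′ (cong proj₂ difference≡0))
  where
  eval-difference : ∀ a b a′ b′ x → (a - a′) * x + (b - b′) ≡ (a * x + b) - (a′ * x + b′)
  eval-difference = solve-∀
  difference≡0 : (a - a′ , b - b′) ≡ (0ℤ , 0ℤ)
  difference≡0 = eval≡0⇒≡0 (a - a′ , b - b′)
    (ℕₚ.≤-<-trans (ℤₚ.∣i-j∣≤∣i∣+∣j∣ b b′) small)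
    (trans (eval-difference a b a′ b′ (+ t)) (ℤₚ.i≡j⇒i-j≡0 eq))

∣eval∣-large : ∀ {a b c h t} → a ≢ 0ℤ → ∣ b ∣ ≤ c → h ℕ.+ c < t → h < ∣ eval (+ t) (a , b) ∣
∣eval∣-large {a} {b} {c} {h} {t} a≢0 ∣b∣≤c h+c<t = ℕₚ.+-cancelʳ-< c h _ (begin-strict
  h ℕ.+ c                          <⟨ h+c<t ⟩
  t                                ≤⟨ t≤∣a*t+b∣+∣b∣ b t a≢0 ⟩
  ∣ a * + t + b ∣ ℕ.+ ∣ b ∣        ≤⟨ ℕₚ.+-monoʳ-≤ ∣ a * + t + b ∣ ∣b∣≤c ⟩
  ∣ a * + t + b ∣ ℕ.+ c            ∎)
  where open ℕₚ.≤-Reasoning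

NoOpposite-map-eval : ∀ {c t S} → c ℕ.+ c < t → All (Bounded c) S → NoOppositeForms S →
  NoOpposite (map (eval (+ t)) S)
NoOpposite-map-eval {c} {t} {S} c+c<t bounded noOpp = All.map⁺ (All.tabulate opposite∉)
  where
  opposite∉ : ∀ {p} → p ∈ S → - eval (+ t) p ∉ map (eval (+ t)) S
  opposite∉ {p} p∈S opposite∈ =
    let q , q∈S , opposite≡ = ∈-map⁻ (eval (+ t)) opposite∈
        ∣neg-p∣≤c = subst (_≤ c) (sym (ℤₚ.∣-i∣≡∣i∣ (proj₂ p))) (All.lookup bounded p∈S)
        small = ℕₚ.≤-<-trans (ℕₚ.+-mono-≤ ∣neg-p∣≤c (All.lookup bounded q∈S)) c+c<t
        neg-p≡q = eval-injective (neg p) q small (trans (eval-neg (+ t) p) opposite≡)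
    in All.lookup noOpp p∈S (subst (_∈ S) (sym neg-p≡q) q∈S)

momentSum : (ℤ → ℤ → ℤ) → List Form → ℤ
momentSum m S = sumℤ (map (uncurry m) S)

VanishingMoments : List Form → Set
VanishingMoments S = All (λ m → momentSum m S ≡ 0ℤ)
  ( (λ a _ → a) ∷ (λ _ b → b)
  ∷ (λ a _ → a * a * a) ∷ (λ a b → a * a * b) ∷ (λ a b → a * b * b) ∷ (λ _ b → b * b * b) ∷ [])

i^3≡i*i*i : ∀ u → u ^ 3 ≡ u * u * u
i^3≡i*i*i = lemma
  where
  lemma : ∀ u → u * (u * (u * 1ℤ)) ≡ u * u * u
  lemma = solve-∀

sum-map-eval : ∀ x S →
  sumℤ (map (eval x) S) ≡ momentSum (λ a _ → a) S * x + momentSum (λ _ b → b) S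
sum-map-eval x []            = refl
sum-map-eval x ((a , b) ∷ S) =
  trans (cong (λ s → a * x + b + s) (sum-map-eval x S)) (step a b x _ _)
  where
  step : ∀ a b x A B → a * x + b + (A * x + B) ≡ (a + A) * x + (b + B)
  step = solve-∀

sum-cubes-map-eval : ∀ x S → sumℤ (map (_^ 3) (map (eval x) S)) ≡
  momentSum (λ a _ → a * a * a) S * (x * x * x) + 3 * momentSum (λ a b → a * a * b) S * (x * x)
    + 3 * momentSum (λ a b → a * b * b) S * x + momentSum (λ _ b → b * b * b) S
sum-cubes-map-eval x []            = refl
sum-cubes-map-eval x ((a , b) ∷ S) =
  trans (cong₂ _+_ (i^3≡i*i*i (a * x + b)) (sum-cubes-map-eval x S)) (step a b x _ _ _ _)
  where
  step : ∀ a b x A₃ A₂B AB₂ B₃ →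
    (a * x + b) * (a * x + b) * (a * x + b)
      + (A₃ * (x * x * x) + 3 * A₂B * (x * x) + 3 * AB₂ * x + B₃) ≡
    (a * a * a + A₃) * (x * x * x) + 3 * (a * a * b + A₂B) * (x * x)
      + 3 * (a * b * b + AB₂) * x + (b * b * b + B₃)
  step = solve-∀

VanishingMoments⇒Balanced : ∀ {S} → VanishingMoments S → ∀ x → Balanced (map (eval x) S)
VanishingMoments⇒Balanced {S} (a≡0 ∷ b≡0 ∷ a³≡0 ∷ a²b≡0 ∷ ab²≡0 ∷ b³≡0 ∷ []) x = balanced
  (trans (sum-map-eval x S) (cong₂ (λ A B → A * x + B) a≡0 b≡0))
  (trans (sum-cubes-map-eval x S)
    (cong₂ _+_ (cong₂ _+_ (cong₂ _+_ (cong (_* (x * x * x)) a³≡0)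
                                     (cong (λ A → 3 * A * (x * x)) a²b≡0))
                          (cong (λ A → 3 * A * x) ab²≡0))
               b³≡0))

ZeroSumCSSet : List ℤ → Set
ZeroSumCSSet l = IsCSSet l × sumℤ l ≡ 0ℤ

ZeroSumCSSet-map-eval : ∀ {c t S} → c ℕ.+ c < t → (∀ x → Balanced (map (eval x) S)) →
  All (Bounded c) S → NoOppositeForms S → ZeroSumCSSet (map (eval (+ t)) S)
ZeroSumCSSet-map-eval {t = t} c+c<t balanced-S bounded noOpp =
  (Balanced⇒CubeSquare bal , NoOpposite⇒NoZero noOpposite , noOpposite) , Balanced.sum≡0 bal
  where
  bal = balanced-S (+ t)
  noOpposite = NoOpposite-map-eval c+c<t bounded noOpp

record CSTemplate (c : ℕ) (B G : List Form) : Set where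
  constructor template
  field
    moments-base  : VanishingMoments B
    moments-block : VanishingMoments G
    noOpposite    : NoOppositeForms (B ++ G)
    bounded       : All (Bounded c) (B ++ G)

csTemplate? : ∀ c B G → Dec (CSTemplate c B G)
csTemplate? c B G = map′
  (λ (mB , mG , noOpp , bounded) → template mB mG noOpp bounded)
  (λ (template mB mG noOpp bounded) → mB , mG , noOpp , bounded)
  (vanishingMoments? B ×-dec vanishingMoments? G ×-dec
   all? (λ p → ¬? (neg p ∈? (B ++ G))) (B ++ G) ×-dec
   all? (λ p → ∣ proj₂ p ∣ ℕₚ.≤? c) (B ++ G))
  where
  vanishingMoments? : ∀ S → Dec (VanishingMoments S)
  vanishingMoments? S = all? (λ m → momentSum m S ℤₚ.≟ 0ℤ) _

paddedFamily : ∀ {c B G a b} → CSTemplate c B G → (a , b) ∈ B → a ≢ 0ℤ →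
  ∀ k → InfinitelyManyMultisets (ZeroSumCSnSet (length B ℕ.+ k ℕ.* length G))
paddedFamily {c} {B} {G} {a} {b} (template momentsB momentsG noOpp bounded) ab∈B a≢0 k L =
  map (eval (+ t)) S , ((proj₁ zeroSumCS , len) , proj₂ zeroSumCS) , fresh
  where
  S = B ++ concat (replicate k G)
  S⊆B++G : S ⊆ B ++ G
  S⊆B++G = ++⁺ʳ B (concat-replicate-⊆ k G)
  h = height L
  -- t > c + c makes evaluation separate the forms, t > h + c makes the entry at (a , b)
  -- exceed every entry of L.
  t = suc (h ℕ.+ (c ℕ.+ c))
  balanced-S : ∀ x → Balanced (map (eval x) S)
  balanced-S x = subst Balanced (sym (List.map-++ (eval x) B _))
    (Balanced-++ (VanishingMoments⇒Balanced momentsB x)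
      (Balanced-map-concat-replicate (eval x) k G (VanishingMoments⇒Balanced momentsG x)))
  zeroSumCS : ZeroSumCSSet (map (eval (+ t)) S)
  zeroSumCS = ZeroSumCSSet-map-eval (s≤s (ℕₚ.m≤n+m (c ℕ.+ c) h)) balanced-S
    (All-resp-⊇ S⊆B++G bounded) (NoOppositeForms-⊆ S⊆B++G noOpp)
  len : length (map (eval (+ t)) S) ≡ length B ℕ.+ k ℕ.* length G
  len = trans (List.length-map (eval (+ t)) S)
    (trans (List.length-++ B) (cong (length B ℕ.+_) (length-concat-replicate k G)))
  fresh : All (λ m → ¬ (map (eval (+ t)) S ↭ m)) L
  fresh = height<∣x∣⇒¬↭ L (∈-map⁺ (eval (+ t)) (∈-++⁺ˡ {ys = concat (replicate k G)} ab∈B))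
    (∣eval∣-large a≢0 (All.lookup bounded (∈-++⁺ˡ {ys = G} ab∈B))
      (s≤s (ℕₚ.+-monoʳ-≤ h (ℕₚ.m≤m+n c c))))

constants : List ℤ → List Form
constants = map (0ℤ ,_)

block₁ block₂ : List Form
block₁ = constants (-10 ∷ -4 ∷ -2 ∷ 7 ∷ 9 ∷ [])
block₂ = constants (-9 ∷ -5 ∷ -1 ∷ 7 ∷ 8 ∷ [])

base₇ base₈ base₁₀ base₁₁ base₁₄ : List Form
base₇  = (-2 , 0) ∷ (-1 , 2) ∷ (-1 , 6) ∷ (0 , -6) ∷ (1 , -4) ∷ (1 , 4) ∷ (2 , -2) ∷ []
base₈  = (1 , 0) ∷ (1 , 4) ∷ (1 , 7) ∷ (1 , 11) ∷ (-1 , -1) ∷ (-1 , -2) ∷ (-1 , -9) ∷ (-1 , -10) ∷ []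
base₁₀ = (1 , 0) ∷ (1 , 3) ∷ (1 , 3) ∷ (-1 , -1) ∷ (-1 , -1) ∷ (-1 , -4) ∷ constants (-2 ∷ -2 ∷ 1 ∷ 3 ∷ [])
base₁₁ = (1 , 0) ∷ (1 , 2) ∷ (1 , 2) ∷ (1 , 2) ∷ (-1 , -1) ∷ (-1 , -1) ∷ (-1 , -1) ∷ (-1 , -3)
       ∷ constants (-1 ∷ -1 ∷ 2 ∷ [])
base₁₄ = base₇ ++ base₇

family₇ : ∀ k → InfinitelyManyMultisets (ZeroSumCSnSet (7 ℕ.+ k ℕ.* 5))
family₇ = paddedFamily (from-yes (csTemplate? 11 base₇ block₁)) (here refl) (λ ())

family₈ : ∀ k → InfinitelyManyMultisets (ZeroSumCSnSet (8 ℕ.+ k ℕ.* 5))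
family₈ = paddedFamily (from-yes (csTemplate? 11 base₈ block₁)) (here refl) (λ ())

family₁₀ : ∀ k → InfinitelyManyMultisets (ZeroSumCSnSet (10 ℕ.+ k ℕ.* 5))
family₁₀ = paddedFamily (from-yes (csTemplate? 11 base₁₀ block₁)) (here refl) (λ ())

family₁₁ : ∀ k → InfinitelyManyMultisets (ZeroSumCSnSet (11 ℕ.+ k ℕ.* 5))
family₁₁ = paddedFamily (from-yes (csTemplate? 11 base₁₁ block₂)) (here refl) (λ ())

family₁₄ : ∀ k → InfinitelyManyMultisets (ZeroSumCSnSet (14 ℕ.+ k ℕ.* 5))
family₁₄ = paddedFamily (from-yes (csTemplate? 11 base₁₄ block₁)) (here refl) (λ ())

family-10+ : ∀ r k → r < 5 → InfinitelyManyMultisets (ZeroSumCSnSet (10 ℕ.+ (r ℕ.+ k ℕ.* 5)))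
family-10+ 0 k _ = family₁₀ k
family-10+ 1 k _ = family₁₁ k
family-10+ 2 k _ = family₇ (suc k)
family-10+ 3 k _ = family₈ (suc k)
family-10+ 4 k _ = family₁₄ k
family-10+ (suc (suc (suc (suc (suc r))))) k (s≤s (s≤s (s≤s (s≤s (s≤s ())))))

proposition8 : (n : ℕ) → (n ≡ 7 ⊎ n ≡ 8 ⊎ 10 ≤ n) →
    InfinitelyManyMultisets (ZeroSumCSnSet n)
proposition8 n (inj₁ refl)        = family₇ 0
proposition8 n (inj₂ (inj₁ refl)) = family₈ 0
proposition8 n (inj₂ (inj₂ 10≤n)) with ℕₚ.m≤n⇒∃[o]m+o≡n 10≤n
... | m , refl = subst (λ r → InfinitelyManyMultisets (ZeroSumCSnSet (10 ℕ.+ r)))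
  (sym (m≡m%n+[m/n]*n m 5)) (family-10+ (m % 5) (m / 5) (m%n<n m 5))
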